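{- Let $L$ be a reduced Latin square of order $n$ with rows $\sigma_1,\dots,\sigma_n$ (viewed as permutations), and let $\Theta=(\alpha,\beta,\gamma)\in\mathfrak A(L)$. Then for each $i=1,\dots,n$, the permutation $\sigma_{\alpha^{ -1}(1)}^{ -1}\sigma_{\alpha^{ -1}(i)}$ has the same cycle structure as $\sigma_i$.
   Context: A Latin square of order $n$ is an $n\times n$ array with entries in $[n]$ in which each symbol appears exactly once in each row and column. Rows and columns are viewed as permutations in $S_n$ via the convention: symbol $i$ in the $j$th place of a row (or column) $\pi$ means $\pi(i)=j$; permutations are composed right to left. A Latin square is reduced if its first row and first column are the identity permutation. An isotopism $(\alpha,\beta,\gamma)\in S_n^3$ acts by moving the row in position $r$ to position $\alpha(r)$, the column in position $c$ to position $\beta(c)$, and replacing each symbol $s$ by $\gamma(s)$. $\mathfrak A(L)$ is the group of isotopisms fixing $L$. -}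

module Defs where

open import Data.Nat using (ℕ; zero; suc)
open import Data.Nat.DivMod using (_/_)
open import Data.Fin using (Fin; zero; suc; _≟_)
open import Data.Fin.Permutation using (Permutation′; _⟨$⟩ʳ_; _⟨$⟩ˡ_)
open import Data.List using (List; []; _∷_; filter; map; length; upTo; allFin)
open import Data.Product using (Σ; _×_; proj₁)
open import Relation.Binary.PropositionalEquality using (_≡_)
open import Relation.Nullary using (¬_)
import Data.Nat as ℕ

∃!′ : {A : Set} → (A → Set) → Set
∃!′ {A} P = Σ A (λ a → P a × (∀ b → P b → b ≡ a))

-- A square array of order N: L r c is the symbol in row r, column c.
Square : ℕ → Set
Square N = Fin N → Fin N → Fin N

record IsLatin {N : ℕ} (L : Square N) : Set where
  field
    rowUnique : ∀ r s → ∃!′ (λ c → L r c ≡ s)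
    colUnique : ∀ c s → ∃!′ (λ r → L r c ≡ s)

-- Row r as a permutation (paper's convention):
-- symbol s in place c of row r means σ_r(s) = c.
rowPerm : {N : ℕ} {L : Square N} → IsLatin L → Fin N → Fin N → Fin N
rowPerm lat r s = proj₁ (IsLatin.rowUnique lat r s)

rowPermInv : {N : ℕ} → Square N → Fin N → Fin N → Fin N
rowPermInv L r c = L r c

-- Reduced: first row and first column are the identity permutation,
-- i.e. L 0 c = c and L r 0 = r (index 1 of the paper is Fin's zero).
IsReduced : {N : ℕ} → Square (suc N) → Set
IsReduced L = (∀ c → L zero c ≡ c) × (∀ r → L r zero ≡ r)

IsAutotopism : {N : ℕ} → Square N → Permutation′ N → Permutation′ N → Permutation′ N → Set
IsAutotopism L α β γ = ∀ r c → L (α ⟨$⟩ʳ r) (β ⟨$⟩ʳ c) ≡ γ ⟨$⟩ʳ (L r c)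

iterate : {N : ℕ} → (Fin N → Fin N) → ℕ → Fin N → Fin N
iterate f zero x = x
iterate f (suc m) x = f (iterate f m x)

-- Length of the cycle through x: least m ∈ {1,…,N} with f^m(x) = x
-- (0 if none, which never happens for a permutation).
cycleLength : {N : ℕ} → (Fin N → Fin N) → Fin N → ℕ
cycleLength {N} f x with filter (λ m → iterate f m x ≟ x) (map suc (upTo N))
... | [] = 0
... | m ∷ _ = m

pointsOnCycles : {N : ℕ} → (Fin N → Fin N) → ℕ → ℕ
pointsOnCycles {N} f k = length (filter (λ x → cycleLength f x ℕ.≟ k) (allFin N))

-- Number of cycles of length k+1.
numCycles : {N : ℕ} → (Fin N → Fin N) → ℕ → ℕ
numCycles f k = pointsOnCycles f (suc k) / suc k

SameCycleStructure : {N : ℕ} → (Fin N → Fin N) → (Fin N → Fin N) → Set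
SameCycleStructure f g = ∀ k → numCycles f k ≡ numCycles g k

module Submission where

open import Defs
open import Data.Nat using (ℕ; suc)
open import Data.Fin using (Fin; zero)
open import Data.Fin.Permutation using (Permutation′; _⟨$⟩ˡ_)

-- Write σ_r for the permutation of row r and read an
-- autotopism (α,β,γ) row by row: row α(r) of L is row r with its symbols
-- renamed by γ and its places moved by β, i.e.  σ_{α(r)} ∘ γ = β ∘ σ_r.
-- For a reduced square, row 0 is the identity, so taking r = α⁻¹(0) gives
-- σ_{α⁻¹(0)}⁻¹ = γ⁻¹ ∘ β, and taking r = α⁻¹(i) gives σ_i ∘ γ = β ∘ σ_{α⁻¹(i)}.
-- Together:  σ_{α⁻¹(0)}⁻¹ ∘ σ_{α⁻¹(i)} = γ⁻¹ ∘ σ_i ∘ γ,  a conjugate of σ_i.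

open import Data.Nat as ℕ using (zero; _/_)
import Data.Nat.Properties as ℕ
open import Data.Fin as Fin using (suc)
open import Data.Fin.Permutation using (_⟨$⟩ʳ_; inverseˡ; inverseʳ)
open import Data.List using ([]; _∷_; filter; map; length; upTo; tabulate)
open import Data.List.Properties using (filter-≐)
open import Data.Product using (_,_; proj₁; proj₂)
open import Relation.Binary.PropositionalEquality
open import Relation.Nullary using (Dec; yes; no)
open import Relation.Unary using (Pred; Decidable)
open import Function using (_∘_; id)
import Algebra.Properties.CommutativeMonoid.Sum ℕ.+-0-commutativeMonoid as ℕSum

indicator : ∀ {p} {P : Set p} → Dec P → ℕ
indicator (yes _) = 1
indicator (no _)  = 0

-- Counting by filtering a tabulated list is summing indicators; this turns
-- point counts into sums, which can be reindexed along a permutation.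
length-filter-tabulate : ∀ {p} {A : Set} {P : Pred A p} (P? : Decidable P)
  (n : ℕ) (f : Fin n → A) →
  length (filter P? (tabulate f)) ≡ ℕSum.sum (λ i → indicator (P? (f i)))
length-filter-tabulate P? zero    f = refl
length-filter-tabulate P? (suc n) f with P? (f zero)
... | yes _ = cong suc (length-filter-tabulate P? n (f ∘ suc))
... | no  _ = length-filter-tabulate P? n (f ∘ suc)

module Conjugation {N : ℕ} (γ : Permutation′ N) (g f : Fin N → Fin N)
  (f≗γ⁻¹gγ : ∀ x → f x ≡ γ ⟨$⟩ˡ g (γ ⟨$⟩ʳ x)) where

  iterate-conj : ∀ m x → iterate f m x ≡ γ ⟨$⟩ˡ iterate g m (γ ⟨$⟩ʳ x)
  iterate-conj zero    x = sym (inverseˡ γ)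
  iterate-conj (suc m) x = begin
    f (iterate f m x)                                  ≡⟨ f≗γ⁻¹gγ _ ⟩
    γ ⟨$⟩ˡ g (γ ⟨$⟩ʳ iterate f m x)                    ≡⟨ cong (λ y → γ ⟨$⟩ˡ g (γ ⟨$⟩ʳ y)) (iterate-conj m x) ⟩
    γ ⟨$⟩ˡ g (γ ⟨$⟩ʳ (γ ⟨$⟩ˡ iterate g m (γ ⟨$⟩ʳ x)))  ≡⟨ cong (λ y → γ ⟨$⟩ˡ g y) (inverseʳ γ) ⟩
    γ ⟨$⟩ˡ g (iterate g m (γ ⟨$⟩ʳ x))                  ∎
    where open ≡-Reasoning

  returns⇒ : ∀ {m x} → iterate f m x ≡ x → iterate g m (γ ⟨$⟩ʳ x) ≡ γ ⟨$⟩ʳ x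
  returns⇒ {m} {x} e = begin
    iterate g m (γ ⟨$⟩ʳ x)                  ≡⟨ inverseʳ γ ⟨
    γ ⟨$⟩ʳ (γ ⟨$⟩ˡ iterate g m (γ ⟨$⟩ʳ x))  ≡⟨ cong (γ ⟨$⟩ʳ_) (iterate-conj m x) ⟨
    γ ⟨$⟩ʳ iterate f m x                    ≡⟨ cong (γ ⟨$⟩ʳ_) e ⟩
    γ ⟨$⟩ʳ x                                ∎
    where open ≡-Reasoning

  returns⇐ : ∀ {m x} → iterate g m (γ ⟨$⟩ʳ x) ≡ γ ⟨$⟩ʳ x → iterate f m x ≡ x
  returns⇐ {m} {x} e = trans (iterate-conj m x) (trans (cong (γ ⟨$⟩ˡ_) e) (inverseˡ γ))

  -- The cycle of f through x has the length of the cycle of g through γ x,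
  -- since both are the first return time found by the same search.
  cycleLength-conj : ∀ x → cycleLength f x ≡ cycleLength g (γ ⟨$⟩ʳ x)
  cycleLength-conj x
    with filter (λ m → iterate f m x Fin.≟ x) (map suc (upTo N))
       | filter (λ m → iterate g m (γ ⟨$⟩ʳ x) Fin.≟ γ ⟨$⟩ʳ x) (map suc (upTo N))
       | filter-≐ (λ m → iterate f m x Fin.≟ x)
                  (λ m → iterate g m (γ ⟨$⟩ʳ x) Fin.≟ γ ⟨$⟩ʳ x)
                  ((λ {m} → returns⇒ {m}) , (λ {m} → returns⇐ {m})) (map suc (upTo N))
  ... | []    | _ | refl = refl
  ... | m ∷ _ | _ | refl = refl

  -- γ maps the points on k-cycles of f bijectively to those of g.
  pointsOnCycles-conj : ∀ k → pointsOnCycles f k ≡ pointsOnCycles g k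
  pointsOnCycles-conj k = begin
    pointsOnCycles f k                                 ≡⟨ length-filter-tabulate onCycleᶠ N id ⟩
    ℕSum.sum (λ x → indicator (onCycleᶠ x))            ≡⟨ ℕSum.sum-cong-≗ (λ x → cong (λ l → indicator (l ℕ.≟ k)) (cycleLength-conj x)) ⟩
    ℕSum.sum (λ x → indicator (onCycleᵍ (γ ⟨$⟩ʳ x)))   ≡⟨ ℕSum.sum-permute (indicator ∘ onCycleᵍ) γ ⟨
    ℕSum.sum (λ x → indicator (onCycleᵍ x))            ≡⟨ length-filter-tabulate onCycleᵍ N id ⟨
    pointsOnCycles g k                                 ∎
    where
    open ≡-Reasoning
    onCycleᶠ = λ x → cycleLength f x ℕ.≟ k
    onCycleᵍ = λ x → cycleLength g x ℕ.≟ k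

  sameCycleStructure-conj : SameCycleStructure f g
  sameCycleStructure-conj k = cong (_/ suc k) (pointsOnCycles-conj (suc k))

module _ {N : ℕ} {L : Square N} (lat : IsLatin L) where

  rowPerm-spec : ∀ r s → L r (rowPerm lat r s) ≡ s
  rowPerm-spec r s = proj₁ (proj₂ (IsLatin.rowUnique lat r s))

  rowPerm-unique : ∀ {r s c} → L r c ≡ s → c ≡ rowPerm lat r s
  rowPerm-unique {r} {s} {c} = proj₂ (proj₂ (IsLatin.rowUnique lat r s)) c

  autotopism-rowPerm : ∀ α β γ → IsAutotopism L α β γ →
    ∀ r s → β ⟨$⟩ʳ rowPerm lat r s ≡ rowPerm lat (α ⟨$⟩ʳ r) (γ ⟨$⟩ʳ s)
  autotopism-rowPerm α β γ aut r s =
    rowPerm-unique (trans (aut r _) (cong (γ ⟨$⟩ʳ_) (rowPerm-spec r s)))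

autotopism-rowAboveTop : ∀ {N} (L : Square (suc N)) α β γ →
  (∀ c → L zero c ≡ c) → IsAutotopism L α β γ →
  ∀ c → L (α ⟨$⟩ˡ zero) c ≡ γ ⟨$⟩ˡ (β ⟨$⟩ʳ c)
autotopism-rowAboveTop L α β γ firstRow aut c = begin
  L (α ⟨$⟩ˡ zero) c                          ≡⟨ inverseˡ γ ⟨
  γ ⟨$⟩ˡ (γ ⟨$⟩ʳ L (α ⟨$⟩ˡ zero) c)          ≡⟨ cong (γ ⟨$⟩ˡ_) (aut (α ⟨$⟩ˡ zero) c) ⟨
  γ ⟨$⟩ˡ L (α ⟨$⟩ʳ (α ⟨$⟩ˡ zero)) (β ⟨$⟩ʳ c) ≡⟨ cong (λ r → γ ⟨$⟩ˡ L r (β ⟨$⟩ʳ c)) (inverseʳ α) ⟩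
  γ ⟨$⟩ˡ L zero (β ⟨$⟩ʳ c)                   ≡⟨ cong (γ ⟨$⟩ˡ_) (firstRow (β ⟨$⟩ʳ c)) ⟩
  γ ⟨$⟩ˡ (β ⟨$⟩ʳ c)                          ∎
  where open ≡-Reasoning

lemma5p1 : (n : ℕ) (L : Square (suc n)) (lat : IsLatin L) → IsReduced L →
    (α β γ : Permutation′ (suc n)) → IsAutotopism L α β γ →
    (i : Fin (suc n)) →
    SameCycleStructure
      (λ x → rowPermInv L (α ⟨$⟩ˡ zero) (rowPerm lat (α ⟨$⟩ˡ i) x))
      (rowPerm lat i)
lemma5p1 n L lat (firstRow , _) α β γ aut i =
  Conjugation.sameCycleStructure-conj γ (rowPerm lat i) _ conjugate
  where
  conjugate : ∀ x → L (α ⟨$⟩ˡ zero) (rowPerm lat (α ⟨$⟩ˡ i) x)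
                  ≡ γ ⟨$⟩ˡ rowPerm lat i (γ ⟨$⟩ʳ x)
  conjugate x = begin
    L (α ⟨$⟩ˡ zero) (rowPerm lat (α ⟨$⟩ˡ i) x)           ≡⟨ autotopism-rowAboveTop L α β γ firstRow aut _ ⟩
    γ ⟨$⟩ˡ (β ⟨$⟩ʳ rowPerm lat (α ⟨$⟩ˡ i) x)             ≡⟨ cong (γ ⟨$⟩ˡ_) (autotopism-rowPerm lat α β γ aut (α ⟨$⟩ˡ i) x) ⟩
    γ ⟨$⟩ˡ rowPerm lat (α ⟨$⟩ʳ (α ⟨$⟩ˡ i)) (γ ⟨$⟩ʳ x)   ≡⟨ cong (λ r → γ ⟨$⟩ˡ rowPerm lat r (γ ⟨$⟩ʳ x)) (inverseʳ α) ⟩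
    γ ⟨$⟩ˡ rowPerm lat i (γ ⟨$⟩ʳ x)                      ∎
    where open ≡-Reasoning
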